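{- Let $r_1,r_2,r_3$ be positive integers with $r_1\ge 2$ and $\gcd(r_1,r_2)=\gcd(r_1,r_3)=1$, and consider the numerical semigroups ${\sf S}(r_1^2,\,r_1r_2+r_1^2k,\,r_3-r_1^2k)$, $k\in\mathbb{Z}$. Suppose that for some integer $k_*$ and some positive integer $g_*$ the linear dependence $$r_1r_2+r_1^2k_*=g_*\,(r_3-r_1^2k_*)$$ holds. Then ${\sf S}(r_1^2,\,r_1r_2+r_1^2k_*,\,r_3-r_1^2k_*)$ coincides with the two-generated (hence symmetric) semigroup ${\sf S}(r_1^2,\,r_3-r_1^2k_*)$; moreover $g_*$ is divisible by $r_1$, and $r_1r_2+r_3$ is divisible by $g_*+1$.
   Context: For positive integers $d_1,\dots,d_m$ with $\gcd(d_1,\dots,d_m)=1$, ${\sf S}(d_1,\dots,d_m)=\{\sum_{i=1}^m x_id_i : x_i\in\mathbb{Z}_{\ge 0}\}$. A numerical semigroup is symmetric if for every integer $s$: $s\in{\sf S}$ iff $F-s\notin{\sf S}$, where $F$ (the Frobenius number) is the largest positive integer not in ${\sf S}$. -}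

module Defs where

open import Data.Nat using (ℕ)
open import Data.Integer using (ℤ; _+_; _*_; _-_; _>_; +_)
open import Data.Product using (Σ; ∃; _×_)
open import Relation.Nullary using (¬_)
open import Function.Bundles using (_⇔_)

InS₃ : ℤ → ℤ → ℤ → ℤ → Set
InS₃ a b c s = ∃ λ (x : ℕ) → ∃ λ (y : ℕ) → ∃ λ (z : ℕ) → s ≡' (+ x * a + + y * b + + z * c)
  where
  open import Relation.Binary.PropositionalEquality using () renaming (_≡_ to _≡'_)

InS₂ : ℤ → ℤ → ℤ → Set
InS₂ a b s = ∃ λ (x : ℕ) → ∃ λ (y : ℕ) → s ≡' (+ x * a + + y * b)
  where
  open import Relation.Binary.PropositionalEquality using () renaming (_≡_ to _≡'_)

IsFrobenius : (ℤ → Set) → ℤ → Set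
IsFrobenius S F = ¬ S F × (∀ s → s > F → S s)

IsSymmetric : (ℤ → Set) → Set
IsSymmetric S = ∃ λ F → IsFrobenius S F × (∀ s → S s ⇔ (¬ S (F - s)))

module Submission where

-- Write a = r₁², b = r₁r₂ + r₁²k, c = r₃ − r₁²k.  The hypothesis says
-- b = g·c with g > 0, so b is a non-negative multiple of c and is redundant as a
-- generator: S(a,b,c) = S(a,c).  Squaring a Bézout identity α r₁ + β r₃ = 1 and
-- substituting r₃ = c + r₁²k gives one for a and c, so S(a,c) is a two-generated
-- numerical semigroup; such semigroups are symmetric with Frobenius number ac − a − c.
-- That classical fact is proved via the normal form s = x a + y c, 0 ≤ y < a: then
-- s ∈ S(a,c) iff x ≥ 0, and F − s has normal form (−1−x) a + (a−1−y) c.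
-- Finally r₃ g = r₁ (r₂ + r₁k + g r₁k), so r₁ ∣ g by coprimality of r₁ and r₃, and
-- r₁r₂ + r₃ = b + c = (g+1) c.

open import Defs
open import Data.Nat using (ℕ)
open import Data.Integer using (ℤ; _+_; _*_; _-_; _>_; _≥_; +_; ∣_∣)
open import Data.Integer.Divisibility using (_∣_)
open import Data.Nat.GCD using (gcd)
open import Data.Product using (_×_)
open import Relation.Binary.PropositionalEquality using (_≡_)
open import Function.Bundles using (_⇔_)

import Data.Nat as ℕ
open import Data.Nat using (suc; zero; s≤s; z≤n)
import Data.Nat.Properties as ℕ
open import Data.Nat.Coprimality using (coprime-Bézout; gcd≡1⇒coprime)
open import Data.Nat.Divisibility using (∣⇒≤)
open import Data.Nat.GCD using (module Bézout)
open import Data.Integer using (-[1+_]; -_; 1ℤ; 0ℤ; +≤+; +<+; _%ℕ_; _/ℕ_)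
open import Data.Integer.Properties
  using (pos-+; pos-*; ⊖-≥; m-n≡m⊖n; 0≤i⇒+∣i∣≡i; 0≤i-j⇒j≤i; ≤-trans; <⇒≤; <⇒≱; +-inverseʳ; +-identityʳ; +-comm; *-identityʳ)
open import Data.Integer.DivMod using (a≡a%ℕn+[a/ℕn]*n; n%ℕd<d)
open import Data.Integer.Divisibility.Signed using (divides; ∣⇒∣ᵤ)
open import Data.Integer.Tactic.RingSolver using (solve-∀)
open import Data.Product using (∃₂; _,_)
open import Data.Empty using (⊥-elim)
open import Function.Bundles using (mk⇔; Equivalence)
open import Relation.Nullary using (¬_; yes; no; contraposition)
open import Relation.Binary.PropositionalEquality using (refl; sym; trans; cong; cong₂; subst; subst₂; module ≡-Reasoning)

open Equivalence using (to; from)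

pos-∸ : ∀ {m n} → m ℕ.≤ n → + (n ℕ.∸ m) ≡ + n - + m
pos-∸ {m} {n} m≤n = trans (sym (⊖-≥ m≤n)) (sym (m-n≡m⊖n n m))

rearrange-Bézout : ∀ X Y M N → 1ℤ + Y * N ≡ X * M → X * M + (- Y) * N ≡ 1ℤ
rearrange-Bézout X Y M N e = trans (cong (λ w → w + (- Y) * N) (sym e)) (cancel Y N)
  where
  cancel : ∀ Y N → (1ℤ + Y * N) + (- Y) * N ≡ 1ℤ
  cancel = solve-∀

castℤ : ∀ x y m n → 1 ℕ.+ y ℕ.* n ≡ x ℕ.* m → 1ℤ + + y * + n ≡ + x * + m
castℤ x y m n e = trans (cong (λ z → 1ℤ + z) (sym (pos-* y n))) (trans (cong +_ e) (pos-* x m))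

bézoutℤ : ∀ {m n} → Bézout.Identity 1 m n → ∃₂ λ α β → α * + m + β * + n ≡ 1ℤ
bézoutℤ {m} {n} (Bézout.+- x y e) = + x , - + y , rearrange-Bézout (+ x) (+ y) (+ m) (+ n) (castℤ x y m n e)
bézoutℤ {m} {n} (Bézout.-+ x y e) = - + x , + y , swap (+ y * + n) (- + x * + m) (rearrange-Bézout (+ y) (+ x) (+ n) (+ m) (castℤ y x n m e))
  where
  swap : ∀ p q → p + q ≡ 1ℤ → q + p ≡ 1ℤ
  swap p q = trans (+-comm q p)

coprime⇒bézout : ∀ r t → r ≥ 0ℤ → t ≥ 0ℤ → gcd ∣ r ∣ ∣ t ∣ ≡ 1 → ∃₂ λ α β → α * r + β * t ≡ 1ℤ
coprime⇒bézout r t r≥0 t≥0 g≡1 with bézoutℤ (coprime-Bézout (gcd≡1⇒coprime g≡1))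
... | α , β , e = α , β , subst₂ (λ p q → α * p + β * q ≡ 1ℤ) (0≤i⇒+∣i∣≡i r≥0) (0≤i⇒+∣i∣≡i t≥0) e

-- Squaring α r + β t = 1 shows that r² is coprime to every t − r² k.
bézout-square-shift : ∀ α β r t k → α * r + β * t ≡ 1ℤ → ∃₂ λ u v → u * (r * r) + v * (t - r * r * k) ≡ 1ℤ
bézout-square-shift α β r t k e =
  γ * γ , + 2 * γ * r * β + β * β * (t - r * r * k) , trans (expand α β r t k) (cong (λ w → w * w) e)
  where
  γ : ℤ
  γ = α + β * r * k
  expand : ∀ α β r t k →
    (α + β * r * k) * (α + β * r * k) * (r * r) + (+ 2 * (α + β * r * k) * r * β + β * β * (t - r * r * k)) * (t - r * r * k)
      ≡ (α * r + β * t) * (α * r + β * t)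
  expand = solve-∀

bézout-cancel : ∀ u v {a c} t w → u * a + v * c ≡ 1ℤ → t * c ≡ w * a → a ∣ t
bézout-cancel u v {a} {c} t w bez e = ∣⇒∣ᵤ (divides (t * u + v * w) (begin
  t                           ≡⟨ sym (*-identityʳ t) ⟩
  t * 1ℤ                      ≡⟨ cong (t *_) (sym bez) ⟩
  t * (u * a + v * c)         ≡⟨ distribute t u a v c ⟩
  t * u * a + v * (t * c)     ≡⟨ cong (λ z → t * u * a + v * z) e ⟩
  t * u * a + v * (w * a)     ≡⟨ collect t u a v w ⟩
  (t * u + v * w) * a         ∎))
  where
  open ≡-Reasoning
  distribute : ∀ t u a v c → t * (u * a + v * c) ≡ t * u * a + v * (t * c)
  distribute = solve-∀
  collect : ∀ t u a v w → t * u * a + v * (w * a) ≡ (t * u + v * w) * a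
  collect = solve-∀

sign-reflection : ∀ x → x ≥ 0ℤ ⇔ (¬ (- 1ℤ - x ≥ 0ℤ))
sign-reflection x = mk⇔ (both-nonneg x) (one-nonneg x)
  where
  both-nonneg : ∀ x → x ≥ 0ℤ → ¬ (- 1ℤ - x ≥ 0ℤ)
  both-nonneg (+ zero)  _ ()
  both-nonneg (+ suc n) _ ()
  one-nonneg : ∀ x → ¬ (- 1ℤ - x ≥ 0ℤ) → x ≥ 0ℤ
  one-nonneg (+ n)    _ = +≤+ z≤n
  one-nonneg -[1+ n ] h = ⊥-elim (h (+≤+ z≤n))

cofactor-nonneg : ∀ P A' n → P * + suc A' ≡ + n → P ≥ 0ℤ
cofactor-nonneg (+ p)    A' n e = +≤+ z≤n
cofactor-nonneg -[1+ p ] A' n ()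

exchange : ∀ x y x' y' a c → x * a + y * c ≡ x' * a + y' * c → (x - x') * a ≡ (y' - y) * c
exchange x y x' y' a c e = begin
  (x - x') * a                         ≡⟨ expand x x' y a c ⟩
  (x * a + y * c) - (x' * a + y * c)   ≡⟨ cong (λ w → w - (x' * a + y * c)) e ⟩
  (x' * a + y' * c) - (x' * a + y * c) ≡⟨ collect x' y' y a c ⟩
  (y' - y) * c                         ∎
  where
  open ≡-Reasoning
  expand : ∀ x x' y a c → (x - x') * a ≡ (x * a + y * c) - (x' * a + y * c)
  expand = solve-∀
  collect : ∀ x' y' y a c → (x' * a + y' * c) - (x' * a + y * c) ≡ (y' - y) * c
  collect = solve-∀

module TwoGenerated (A' C' : ℕ) (u v : ℤ) (bez : u * + suc A' + v * + suc C' ≡ 1ℤ) where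
  A : ℕ
  A = suc A'
  a c : ℤ
  a = + A
  c = + suc C'
  S : ℤ → Set
  S = InS₂ a c

  nonneg : ∀ s → S s → s ≥ 0ℤ
  nonneg s (x , y , e) = subst (_≥ 0ℤ) (sym (trans e as-ℕ)) (+≤+ z≤n)
    where
    as-ℕ : + x * a + + y * c ≡ + (x ℕ.* A ℕ.+ y ℕ.* suc C')
    as-ℕ = sym (trans (pos-+ (x ℕ.* A) _) (cong₂′ (pos-* x A) (pos-* y (suc C'))))
      where
      cong₂′ : ∀ {p p' q q'} → p ≡ p' → q ≡ q' → p + q ≡ p' + q'
      cong₂′ refl refl = refl

  normal-form : ∀ s → ∃₂ λ x y → y ℕ.< A × s ≡ x * a + + y * c
  normal-form s = s * u + q * c , y , n%ℕd<d t A , (begin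
    s                               ≡⟨ sym (*-identityʳ s) ⟩
    s * 1ℤ                          ≡⟨ cong (s *_) (sym bez) ⟩
    s * (u * a + v * c)             ≡⟨ distribute s u a v c ⟩
    s * u * a + t * c               ≡⟨ cong (λ w → s * u * a + w * c) (a≡a%ℕn+[a/ℕn]*n t A) ⟩
    s * u * a + (+ y + q * a) * c   ≡⟨ regroup s u a c (+ y) q ⟩
    (s * u + q * c) * a + + y * c   ∎)
    where
    open ≡-Reasoning
    t q : ℤ
    t = s * v
    q = t /ℕ A
    y : ℕ
    y = t %ℕ A
    distribute : ∀ s u a v c → s * (u * a + v * c) ≡ s * u * a + (s * v) * c
    distribute = solve-∀
    regroup : ∀ s u a c y q → s * u * a + (y + q * a) * c ≡ (s * u + q * c) * a + y * c
    regroup = solve-∀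

  member⇒nonneg : ∀ x y → y ℕ.< A → S (x * a + + y * c) → x ≥ 0ℤ
  member⇒nonneg x y y<A (x' , y' , e) with y ℕ.≤? y'
  ... | yes y≤y' = ≤-trans (+≤+ z≤n) (0≤i-j⇒j≤i (cofactor-nonneg (x - + x') A' _ shifted))
    where
    -- (x − x') a = (y' − y) c is a natural number, so x ≥ x' ≥ 0.
    shifted : (x - + x') * a ≡ + ((y' ℕ.∸ y) ℕ.* suc C')
    shifted = trans (exchange x (+ y) (+ x') (+ y') a c e)
                    (trans (cong (_* c) (sym (pos-∸ y≤y'))) (sym (pos-* (y' ℕ.∸ y) (suc C'))))
  ... | no y≰y' = ⊥-elim (ℕ.<⇒≱ d<A (∣⇒≤ {{ℕ.>-nonZero 0<d}} a∣d))
    where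
    -- Otherwise 0 < d = y − y' < a while a divides d c, hence d: impossible.
    y'<y : y' ℕ.< y
    y'<y = ℕ.≰⇒> y≰y'
    d : ℕ
    d = y ℕ.∸ y'
    0<d : 0 ℕ.< d
    0<d = ℕ.m<n⇒0<n∸m y'<y
    d<A : d ℕ.< A
    d<A = ℕ.≤-<-trans (ℕ.m∸n≤m y y') y<A
    dc≡ : + d * c ≡ (+ x' - x) * a
    dc≡ = trans (cong (_* c) (pos-∸ (ℕ.<⇒≤ y'<y))) (sym (exchange (+ x') (+ y') x (+ y) a c (sym e)))
    a∣d : a ∣ + d
    a∣d = bézout-cancel u v (+ d) (+ x' - x) bez dc≡

  member⇔nonneg : ∀ x y → y ℕ.< A → S (x * a + + y * c) ⇔ (x ≥ 0ℤ)
  member⇔nonneg x y y<A = mk⇔ (member⇒nonneg x y y<A) nonneg⇒member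
    where
    nonneg⇒member : x ≥ 0ℤ → S (x * a + + y * c)
    nonneg⇒member (+≤+ {n = n} _) = n , y , refl

  F : ℤ
  F = a * c - a - c

  reflect : ∀ x y → y ℕ.< A → F - (x * a + + y * c) ≡ (- 1ℤ - x) * a + + (A' ℕ.∸ y) * c
  reflect x y y<A = trans (rewrite-F x (+ y) (+ A') c)
                          (cong (λ w → (- 1ℤ - x) * a + w * c) (sym (pos-∸ (ℕ.≤-pred y<A))))
    where
    rewrite-F : ∀ x Y Az c → (1ℤ + Az) * c - (1ℤ + Az) - c - (x * (1ℤ + Az) + Y * c)
                             ≡ (- 1ℤ - x) * (1ℤ + Az) + (Az - Y) * c
    rewrite-F = solve-∀

  symmetry : ∀ s → S s ⇔ (¬ S (F - s))
  symmetry s with normal-form s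
  ... | x , y , y<A , refl = mk⇔
    (λ h h' → to (sign-reflection x) (to (member⇔nonneg x y y<A) h) (to reflected h'))
    (λ h → from (member⇔nonneg x y y<A) (from (sign-reflection x) (contraposition (from reflected) h)))
    where
    reflected : S (F - (x * a + + y * c)) ⇔ (- 1ℤ - x ≥ 0ℤ)
    reflected = subst (λ z → S z ⇔ (- 1ℤ - x ≥ 0ℤ)) (sym (reflect x y y<A))
                      (member⇔nonneg (- 1ℤ - x) (A' ℕ.∸ y) (s≤s (ℕ.m∸n≤m A' y)))

  -- F ∉ S because F − F = 0 ∈ S; every s > F lies in S because F − s < 0 ∉ S.
  frobenius : IsFrobenius S F
  frobenius = F∉S , above-F
    where
    F∉S : ¬ S F
    F∉S h = to (symmetry F) h (0 , 0 , +-inverseʳ F)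
    above-F : ∀ s → s > F → S s
    above-F s s>F = from (symmetry s) λ h → <⇒≱ s>F (0≤i-j⇒j≤i (nonneg _ h))

  symmetric : IsSymmetric S
  symmetric = F , frobenius , symmetry

two-generated-symmetric : ∀ a c → a > 0ℤ → c > 0ℤ → ∀ u v → u * a + v * c ≡ 1ℤ → IsSymmetric (InS₂ a c)
two-generated-symmetric (+ suc A') (+ suc C') (+<+ _) (+<+ _) u v bez = TwoGenerated.symmetric A' C' u v bez

redundant-generator : ∀ a b c g → g ≥ 0ℤ → b ≡ g * c → ∀ s → InS₃ a b c s ⇔ InS₂ a c s
redundant-generator a b c (+ G) (+≤+ _) b≡Gc s = mk⇔ drop-b add-b
  where
  absorb : ∀ x y z → + x * a + + y * (+ G * c) + + z * c ≡ + x * a + + (y ℕ.* G ℕ.+ z) * c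
  absorb x y z = trans (regroup (+ x) (+ y) (+ z) a c (+ G))
                       (cong (λ w → + x * a + w * c) (sym (trans (pos-+ (y ℕ.* G) z) (cong (_+ + z) (pos-* y G)))))
    where
    regroup : ∀ X Y Z a c g → X * a + Y * (g * c) + Z * c ≡ X * a + (Y * g + Z) * c
    regroup = solve-∀
  drop-b : InS₃ a b c s → InS₂ a c s
  drop-b (x , y , z , e) = x , y ℕ.* G ℕ.+ z , trans e (trans (cong (λ w → + x * a + + y * w + + z * c) b≡Gc) (absorb x y z))
  add-b : InS₂ a c s → InS₃ a b c s
  add-b (x , y , e) = x , 0 , y , trans e (cong (_+ + y * c) (sym (+-identityʳ (+ x * a))))

square-pos : ∀ r → r ≥ + 2 → r * r > 0ℤ
square-pos (+ suc (suc n)) (+≤+ (s≤s (s≤s z≤n))) = +<+ (s≤s z≤n)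

lemma2 : (r₁ r₂ r₃ : ℤ) → r₁ ≥ + 2 → r₂ > + 0 → r₃ > + 0 →
    gcd ∣ r₁ ∣ ∣ r₂ ∣ ≡ 1 → gcd ∣ r₁ ∣ ∣ r₃ ∣ ≡ 1 →
    (k g : ℤ) → g > + 0 → r₃ - r₁ * r₁ * k > + 0 →
    r₁ * r₂ + r₁ * r₁ * k ≡ g * (r₃ - r₁ * r₁ * k) →
    (∀ s → (InS₃ (r₁ * r₁) (r₁ * r₂ + r₁ * r₁ * k) (r₃ - r₁ * r₁ * k) s) ⇔ (InS₂ (r₁ * r₁) (r₃ - r₁ * r₁ * k) s))
    × IsSymmetric (InS₂ (r₁ * r₁) (r₃ - r₁ * r₁ * k))
    × (r₁ ∣ g)
    × ((g + + 1) ∣ (r₁ * r₂ + r₃))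
lemma2 r₁ r₂ r₃ r₁≥2 _ r₃>0 _ gcd₁₃≡1 k g g>0 c>0 b≡gc with
  coprime⇒bézout r₁ r₃ (≤-trans (+≤+ z≤n) r₁≥2) (<⇒≤ r₃>0) gcd₁₃≡1
... | α , β , bez with bézout-square-shift α β r₁ r₃ k bez
... | u , v , bez′ =
    redundant-generator a b c g (<⇒≤ g>0) b≡gc
  , two-generated-symmetric a c (square-pos r₁ r₁≥2) c>0 u v bez′
  , bézout-cancel α β g (r₂ + r₁ * k + g * r₁ * k) bez r₃g≡
  , ∣⇒∣ᵤ (divides c sum≡)
  where
  open ≡-Reasoning
  a b c : ℤ
  a = r₁ * r₁
  b = r₁ * r₂ + r₁ * r₁ * k
  c = r₃ - r₁ * r₁ * k
  r₃g≡ : g * r₃ ≡ (r₂ + r₁ * k + g * r₁ * k) * r₁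
  r₃g≡ = begin
    g * r₃                  ≡⟨ split r₁ r₃ g k ⟩
    g * c + g * r₁ * r₁ * k ≡⟨ cong (_+ g * r₁ * r₁ * k) (sym b≡gc) ⟩
    b + g * r₁ * r₁ * k     ≡⟨ factor r₁ r₂ g k ⟩
    (r₂ + r₁ * k + g * r₁ * k) * r₁ ∎
    where
    split : ∀ r₁ r₃ g k → g * r₃ ≡ g * (r₃ - r₁ * r₁ * k) + g * r₁ * r₁ * k
    split = solve-∀
    factor : ∀ r₁ r₂ g k → (r₁ * r₂ + r₁ * r₁ * k) + g * r₁ * r₁ * k ≡ (r₂ + r₁ * k + g * r₁ * k) * r₁
    factor = solve-∀
  sum≡ : r₁ * r₂ + r₃ ≡ c * (g + + 1)
  sum≡ = begin
    r₁ * r₂ + r₃ ≡⟨ split r₁ r₂ r₃ k ⟩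
    b + c        ≡⟨ cong (_+ c) b≡gc ⟩
    g * c + c    ≡⟨ factor g c ⟩
    c * (g + + 1) ∎
    where
    split : ∀ r₁ r₂ r₃ k → r₁ * r₂ + r₃ ≡ (r₁ * r₂ + r₁ * r₁ * k) + (r₃ - r₁ * r₁ * k)
    split = solve-∀
    factor : ∀ g c → g * c + c ≡ c * (g + + 1)
    factor = solve-∀
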